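{- Let $n\ge2$ and let $f$ be the $n$-ary operation on $\mathbb{Z}_8$ given by $f(\mathbf{x})=x_1x_2\cdots x_n\sum_{\alpha\in I_n}b_\alpha\mathbf{x}^\alpha$ with $b_\alpha\in\{0,1\}$ for every $\alpha$. If $f$ preserves the relation $Z$, then $b_\alpha=0$ for every $\alpha$.
   Context: $I_n$ is the set of all $n$-tuples $\alpha\in\{0,1,2\}^n$ with at most two nonzero components, and $\mathbf{x}^\alpha=x_1^{\alpha_1}\cdots x_n^{\alpha_n}$. Let $P_4$ be the power set of $\{1,2,3,4\}$; tuples in $\mathbb{Z}_8^{P_4}$ are written $\mathbf{x}=(x_A\mid A\in P_4)$. For $A\in P_4$ let $\mathbf{g}^A$ have $g^A_B=1$ if $A\subseteq B$ and $0$ otherwise. Every $\mathbf{x}$ is uniquely $\mathbf{x}=\sum_A a_A\mathbf{g}^A$ with $a_A\in\mathbb{Z}_8$ (namely $a_A=(-1)^{|A|}\sum_{B\subseteq A}(-1)^{|B|}x_B$). $Z$ is the set of $\mathbf{x}\in\mathbb{Z}_8^{P_4}$ whose coordinates satisfy: (Z1) $a_{\{2\}}\equiv 2a_{\{1\}}$ and $a_{\{4\}}\equiv 2a_{\{3\}}\pmod 4$; (Z2) $a_A\equiv0\pmod 2$ whenever $|A|\ge2$; (Z3) $a_A\equiv0\pmod4$ whenever $|A|\ge2$ and $A\cap\{2,4\}\ne\emptyset$; (Z4) $a_A=0$ whenever $\{2,4\}\subseteq A$. An $n$-ary operation preserves $Z$ if applying it componentwise to any $n$ tuples of $Z$ yields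 a tuple of $Z$. -}

module Defs where

open import Data.Nat using (ℕ; zero; suc; _+_; _*_; _^_; _≤_; _≤ᵇ_; _%_)
open import Data.Nat.DivMod using (_mod_)
open import Data.Integer using (ℤ; +_; -_) renaming (_+_ to _+ℤ_)
open import Data.Integer.DivMod using (_%ℕ_)
open import Data.Bool using (Bool; true; false; if_then_else_; _∧_; not)
open import Data.Fin using (Fin; zero; suc; toℕ)
open import Data.Fin.Subset using (Subset; ∣_∣; _⊆_; _∈_; _∉_; ⁅_⁆; _∪_; inside; outside)
open import Data.Vec using (Vec; []; _∷_; lookup)
open import Data.List using (List; []; _∷_; map; concatMap; foldr)
open import Data.Nat.ListAction using (sum; product)
open import Data.List.Base using (allFin)
open import Data.Product using (_×_)
open import Relation.Binary.PropositionalEquality using (_≡_)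
open import Relation.Nullary using (¬_)

allVec : {A : Set} → List A → (n : ℕ) → List (Vec A n)
allVec xs zero = [] ∷ []
allVec xs (suc n) = concatMap (λ a → map (a ∷_) (allVec xs n)) xs

allFin3 : List (Fin 3)
allFin3 = zero ∷ suc zero ∷ suc (suc zero) ∷ []

-- Z_8 is Fin 8; arithmetic is done in ℕ and reduced mod 8 at the end.

Z8 : Set
Z8 = Fin 8

isNonzero : Fin 3 → Bool
isNonzero zero = false
isNonzero (suc _) = true

nonzeroCount : {n : ℕ} → Vec (Fin 3) n → ℕ
nonzeroCount [] = 0
nonzeroCount (a ∷ as) = (if isNonzero a then 1 else 0) + nonzeroCount as

InI : {n : ℕ} → Vec (Fin 3) n → Set
InI α = nonzeroCount α ≤ 2

inIᵇ : {n : ℕ} → Vec (Fin 3) n → Bool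
inIᵇ α = nonzeroCount α ≤ᵇ 2

monomial : {n : ℕ} → Vec (Fin 3) n → (Fin n → Z8) → ℕ
monomial {n} α x = product (map (λ i → toℕ (x i) ^ toℕ (lookup α i)) (allFin n))

prodAll : {n : ℕ} → (Fin n → Z8) → ℕ
prodAll {n} x = product (map (λ i → toℕ (x i)) (allFin n))

fOp : (n : ℕ) → (Vec (Fin 3) n → Bool) → (Fin n → Z8) → Z8
fOp n b x =
  (prodAll x *
    sum (map (λ α → if inIᵇ α ∧ b α then monomial α x else 0) (allVec allFin3 n)))
  mod 8

-- P_4 = subsets of {1,2,3,4}, encoded as Subset 4 (element k ↦ Fin index k-1)

P4 : List (Subset 4)
P4 = allVec (false ∷ true ∷ []) 4

subsetᵇ : {m : ℕ} → Subset m → Subset m → Bool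
subsetᵇ [] [] = true
subsetᵇ (p ∷ ps) (q ∷ qs) = (not p Data.Bool.∨ q) ∧ subsetᵇ ps qs

sizeParity : {m : ℕ} → Subset m → ℤ → ℤ
sizeParity [] z = z
sizeParity (outside ∷ s) z = sizeParity s z
sizeParity (inside ∷ s) z = - (sizeParity s z)

coeffA : Subset 4 → (Subset 4 → Z8) → ℕ
coeffA A x =
  sizeParity A
    (foldr _+ℤ_ (+ 0)
      (map (λ B → if subsetᵇ B A then sizeParity B (+ toℕ (x B)) else + 0) P4))
  %ℕ 8

e1 e2 e3 e4 : Fin 4
e1 = zero
e2 = suc zero
e3 = suc (suc zero)
e4 = suc (suc (suc zero))

InZ : (Subset 4 → Z8) → Set
InZ x =
  ((coeffA ⁅ e2 ⁆ x) % 4 ≡ (2 * coeffA ⁅ e1 ⁆ x) % 4) ×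
  ((coeffA ⁅ e4 ⁆ x) % 4 ≡ (2 * coeffA ⁅ e3 ⁆ x) % 4) ×
  (∀ (A : Subset 4) → 2 ≤ ∣ A ∣ → coeffA A x % 2 ≡ 0) ×
  (∀ (A : Subset 4) → 2 ≤ ∣ A ∣ → ¬ (e2 ∉ A × e4 ∉ A) → coeffA A x % 4 ≡ 0) ×
  (∀ (A : Subset 4) → (⁅ e2 ⁆ ∪ ⁅ e4 ⁆) ⊆ A → coeffA A x ≡ 0)

Preserves : (n : ℕ) → ((Fin n → Z8) → Z8) → Set
Preserves n g =
  (xs : Fin n → Subset 4 → Z8) → (∀ i → InZ (xs i)) → InZ (λ A → g (λ i → xs i A))

-- Put the tuples U and V of Z into two coordinates j ≠ k of f and the constant tuple 1 into
-- all others. Coordinatewise the output is Σ_α b_α u v u^{α_j} v^{α_k}, where (u, v) runs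
-- through the coordinates of (U, V). Each of (Z2)–(Z4) says c · a_A ≡ 0 (mod 8) for suitable
-- c and A, and a_A is a signed sum of coordinates; so for each (p, q) a suitable combination
-- of these constraints turns the output into 4 · Σ {b_α | α_j = p, α_k = q} ≡ 0 (mod 8).
-- If α₀ ∈ I_n is supported on {j, k}, every other α in that sum has strictly larger support,
-- so by downward induction on the support size the sum is 4 · b_α₀, and b_α₀ = 0.
module Submission where

open import Defs
open import Data.Bool using (Bool; true; false; T; if_then_else_; _∧_)
open import Data.Fin using (Fin; zero; suc; toℕ; _≟_; #_)
open import Data.Fin.Patterns using (0F; 1F; 2F)
open import Data.Fin.Properties using (suc-injective; toℕ-fromℕ<; all?)
open import Data.Fin.Subset using (Subset; inside; outside; ∣_∣; ⁅_⁆; _∪_; ⊤)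
open import Data.Fin.Subset.Properties using (_∈?_; _⊆?_)
open import Data.Integer using (ℤ; +_; -[1+_]; -_) renaming (_+_ to _+ℤ_; _*_ to _*ℤ_; _-_ to _-ℤ_)
open import Data.Integer.DivMod using (_%ℕ_)
open import Data.Integer.Properties using (pos-*) renaming (+-identityʳ to +ℤ-identityʳ)
open import Data.Integer.Tactic.RingSolver using (solve-∀)
open import Data.List using (List; []; _∷_; map; foldr; _++_; concatMap; tabulate; allFin)
open import Data.List.Properties using (map-++; map-∘; map-tabulate)
open import Data.Nat as ℕ using (ℕ; NonZero; zero; suc; _+_; _*_; _^_; _%_; _≤_; _<_; _≤?_; z≤n; s≤s)
open import Data.Nat.DivMod using (%-distribˡ-+; %-distribˡ-*; m%n%n≡m%n; [m+kn]%n≡m%n)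
open import Data.Nat.Divisibility using (_∣_; m%n≡0⇒n∣m; n∣m⇒m%n≡0; *-monoʳ-∣; m∣m*n)
open import Data.Nat.ListAction using (sum; product)
open import Data.Nat.ListAction.Properties using (sum-++)
open import Data.Nat.Properties
  using (+-identityʳ; *-identityˡ; *-identityʳ; *-assoc; *-comm; *-zeroʳ; *-distribˡ-+; ^-zeroˡ;
         ≤-trans; ≤-<-trans; <-≤-trans; <-irrefl; m≤m+n; m≤n+m; +-suc; +-monoʳ-≤; +-monoʳ-<; ≤ᵇ⇒≤;
         +-commutativeSemigroup; *-commutativeSemigroup)
open import Algebra.Properties.CommutativeSemigroup +-commutativeSemigroup
  using () renaming (interchange to +-interchange)
open import Algebra.Properties.CommutativeSemigroup *-commutativeSemigroup
  using () renaming (x∙yz≈y∙xz to *-exchange)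
open import Data.Product using (Σ; ∃₂; _×_; _,_)
open import Data.Sum using (_⊎_; inj₁; inj₂)
open import Data.Unit using (tt)
open import Data.Vec using (Vec; []; _∷_; lookup)
open import Data.Vec.Properties using (∷-injectiveˡ; ∷-injectiveʳ)
open import Function using (_∘_; id)
open import Level using (0ℓ)
open import Relation.Binary.Bundles using (Setoid)
open import Relation.Binary.PropositionalEquality
open import Relation.Nullary using (Dec; yes; no; does; ¬?; _×-dec_; _→-dec_; map′; contradiction)
open import Relation.Nullary.Decidable using (toWitness; dec-true; dec-false)

private variable
  X Y : Set
  n : ℕ
  u u′ v v′ : ℕ

∑ : List X → (X → ℕ) → ℕ
∑ xs f = sum (map f xs)

infix 5 ∑
syntax ∑ xs (λ x → e) = ∑[ x ← xs ] e

∑-cong : ∀ (xs : List X) {f g : X → ℕ} → (∀ x → f x ≡ g x) → ∑ xs f ≡ ∑ xs g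
∑-cong []       f≡g = refl
∑-cong (x ∷ xs) f≡g = cong₂ _+_ (f≡g x) (∑-cong xs f≡g)

∑-zero : ∀ (xs : List X) {f : X → ℕ} → (∀ x → f x ≡ 0) → ∑ xs f ≡ 0
∑-zero []       f≡0 = refl
∑-zero (x ∷ xs) f≡0 = cong₂ _+_ (f≡0 x) (∑-zero xs f≡0)

∑-+ : ∀ (xs : List X) (f g : X → ℕ) → ∑[ x ← xs ] (f x + g x) ≡ ∑ xs f + ∑ xs g
∑-+ []       f g = refl
∑-+ (x ∷ xs) f g = trans (cong (_+_ (f x + g x)) (∑-+ xs f g)) (+-interchange (f x) (g x) _ _)

∑-*ˡ : ∀ (xs : List X) c (f : X → ℕ) → c * ∑ xs f ≡ ∑[ x ← xs ] c * f x
∑-*ˡ []       c f = *-zeroʳ c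
∑-*ˡ (x ∷ xs) c f = trans (*-distribˡ-+ c (f x) _) (cong (_+_ (c * f x)) (∑-*ˡ xs c f))

∑-comm : ∀ (xs : List X) (ys : List Y) (f : X → Y → ℕ) →
         ∑[ x ← xs ] ∑[ y ← ys ] f x y ≡ ∑[ y ← ys ] ∑[ x ← xs ] f x y
∑-comm []       ys f = sym (∑-zero ys λ _ → refl)
∑-comm (x ∷ xs) ys f = trans (cong (_+_ (∑ ys (f x))) (∑-comm xs ys f)) (sym (∑-+ ys (f x) _))

∑-weighted-comm : ∀ (xs : List X) (ys : List Y) (c : X → ℕ) (g : Y → ℕ) (h : X → Y → ℕ) →
                  ∑[ x ← xs ] c x * (∑[ y ← ys ] g y * h x y) ≡
                  ∑[ y ← ys ] g y * (∑[ x ← xs ] c x * h x y)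
∑-weighted-comm xs ys c g h = begin
  ∑[ x ← xs ] c x * (∑[ y ← ys ] g y * h x y)
    ≡⟨ ∑-cong xs (λ x → ∑-*ˡ ys (c x) _) ⟩
  ∑[ x ← xs ] ∑[ y ← ys ] c x * (g y * h x y)
    ≡⟨ ∑-comm xs ys _ ⟩
  ∑[ y ← ys ] ∑[ x ← xs ] c x * (g y * h x y)
    ≡⟨ ∑-cong ys (λ y → ∑-cong xs λ x → *-exchange (c x) (g y) (h x y)) ⟩
  ∑[ y ← ys ] ∑[ x ← xs ] g y * (c x * h x y)
    ≡⟨ ∑-cong ys (λ y → sym (∑-*ˡ xs (g y) _)) ⟩
  ∑[ y ← ys ] g y * (∑[ x ← xs ] c x * h x y)
    ∎
  where open ≡-Reasoning

∑-map : ∀ (xs : List X) (g : X → Y) (f : Y → ℕ) → ∑ (map g xs) f ≡ ∑ xs (f ∘ g)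
∑-map xs g f = cong sum (sym (map-∘ xs))

∑-concatMap : ∀ (xs : List X) (g : X → List Y) (f : Y → ℕ) →
              ∑ (concatMap g xs) f ≡ ∑[ x ← xs ] ∑ (g x) f
∑-concatMap []       g f = refl
∑-concatMap (x ∷ xs) g f = begin
  sum (map f (g x ++ concatMap g xs))          ≡⟨ cong sum (map-++ f (g x) _) ⟩
  sum (map f (g x) ++ map f (concatMap g xs))  ≡⟨ sum-++ (map f (g x)) _ ⟩
  ∑ (g x) f + ∑ (concatMap g xs) f             ≡⟨ cong (_+_ (∑ (g x) f)) (∑-concatMap xs g f) ⟩
  ∑ (g x) f + (∑[ x ← xs ] ∑ (g x) f)          ∎
  where open ≡-Reasoning

-- A record rather than m % 8 ≡ n % 8 itself, so that m and n can be inferred.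
record _≡₈_ (m n : ℕ) : Set where
  constructor mod₈
  field %8-≡ : m % 8 ≡ n % 8

open _≡₈_

infix 4 _≡₈_

≡₈-setoid : Setoid 0ℓ 0ℓ
≡₈-setoid = record
  { Carrier       = ℕ
  ; _≈_           = _≡₈_
  ; isEquivalence = record
    { refl  = mod₈ refl
    ; sym   = λ a≡b → mod₈ (sym (%8-≡ a≡b))
    ; trans = λ a≡b b≡c → mod₈ (trans (%8-≡ a≡b) (%8-≡ b≡c))
    }
  }

_≡₈?_ : ∀ m n → Dec (m ≡₈ n)
m ≡₈? n = map′ mod₈ %8-≡ (m % 8 ℕ.≟ n % 8)

≡%8⇒≡₈ : u ≡ v % 8 → u ≡₈ v
≡%8⇒≡₈ {v = v} refl = mod₈ (m%n%n≡m%n v 8)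

8∣⇒≡₈0 : 8 ∣ u → u ≡₈ 0
8∣⇒≡₈0 {u} 8∣u = mod₈ (n∣m⇒m%n≡0 u 8 8∣u)

%≡0⇒*≡₈0 : ∀ k d {u} .{{_ : NonZero d}} → k * d ≡ 8 → u % d ≡ 0 → k * u ≡₈ 0
%≡0⇒*≡₈0 k d {u} k*d≡8 u%d≡0 =
  8∣⇒≡₈0 (subst (_∣ k * u) k*d≡8 (*-monoʳ-∣ k (m%n≡0⇒n∣m u d u%d≡0)))

+-cong₈ : u ≡₈ u′ → v ≡₈ v′ → u + v ≡₈ u′ + v′
+-cong₈ {u} {u′} {v} {v′} (mod₈ u≡u′) (mod₈ v≡v′) = mod₈ (begin
  (u + v) % 8            ≡⟨ %-distribˡ-+ u v 8 ⟩
  (u % 8 + v % 8) % 8    ≡⟨ cong₂ (λ x y → (x + y) % 8) u≡u′ v≡v′ ⟩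
  (u′ % 8 + v′ % 8) % 8  ≡⟨ %-distribˡ-+ u′ v′ 8 ⟨
  (u′ + v′) % 8          ∎)
  where open ≡-Reasoning

*-congˡ₈ : ∀ c → u ≡₈ u′ → c * u ≡₈ c * u′
*-congˡ₈ {u} {u′} c (mod₈ u≡u′) = mod₈ (begin
  (c * u) % 8             ≡⟨ %-distribˡ-* c u 8 ⟩
  (c % 8 * (u % 8)) % 8   ≡⟨ cong (λ x → (c % 8 * x) % 8) u≡u′ ⟩
  (c % 8 * (u′ % 8)) % 8  ≡⟨ %-distribˡ-* c u′ 8 ⟨
  (c * u′) % 8            ∎)
  where open ≡-Reasoning

∑-cong₈ : ∀ (xs : List X) {f g : X → ℕ} → (∀ x → f x ≡₈ g x) → ∑ xs f ≡₈ ∑ xs g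
∑-cong₈ []       f≡g = mod₈ refl
∑-cong₈ (x ∷ xs) f≡g = +-cong₈ (f≡g x) (∑-cong₈ xs f≡g)

∑-≡₈0 : ∀ (xs : List X) {f : X → ℕ} → (∀ x → f x ≡₈ 0) → ∑ xs f ≡₈ 0
∑-≡₈0 xs f≡0 =
  Setoid.trans ≡₈-setoid (∑-cong₈ xs f≡0) (mod₈ (cong (_% 8) (∑-zero xs λ _ → refl)))

-- Both sides are shifted by non-negative multiples of 8, so that reducing an integer modulo 8
-- only ever has to be compared before and after adding + 8.
record _≃₈_ (z : ℤ) (n : ℕ) : Set where
  constructor shifts
  field
    k m : ℕ
    eq  : z +ℤ + 8 *ℤ + k ≡ + n +ℤ + 8 *ℤ + m

infix 4 _≃₈_

[z+8]%ℕ8≡z%ℕ8 : ∀ z → (z +ℤ + 8) %ℕ 8 ≡ z %ℕ 8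
[z+8]%ℕ8≡z%ℕ8 (+ n)    = [m+kn]%n≡m%n n 1 8
[z+8]%ℕ8≡z%ℕ8 -[1+ 0 ] = refl
[z+8]%ℕ8≡z%ℕ8 -[1+ 1 ] = refl
[z+8]%ℕ8≡z%ℕ8 -[1+ 2 ] = refl
[z+8]%ℕ8≡z%ℕ8 -[1+ 3 ] = refl
[z+8]%ℕ8≡z%ℕ8 -[1+ 4 ] = refl
[z+8]%ℕ8≡z%ℕ8 -[1+ 5 ] = refl
[z+8]%ℕ8≡z%ℕ8 -[1+ 6 ] = refl
[z+8]%ℕ8≡z%ℕ8 -[1+ 7 ] = refl
[z+8]%ℕ8≡z%ℕ8 -[1+ suc (suc (suc (suc (suc (suc (suc (suc _))))))) ] = refl

[z+8k]%ℕ8≡z%ℕ8 : ∀ z k → (z +ℤ + 8 *ℤ + k) %ℕ 8 ≡ z %ℕ 8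
[z+8k]%ℕ8≡z%ℕ8 z zero    = cong (_%ℕ 8) (+ℤ-identityʳ z)
[z+8k]%ℕ8≡z%ℕ8 z (suc k) = begin
  (z +ℤ + 8 *ℤ + suc k) %ℕ 8     ≡⟨ cong (_%ℕ 8) (shift-out z (+ k)) ⟩
  (z +ℤ + 8 *ℤ + k +ℤ + 8) %ℕ 8  ≡⟨ [z+8]%ℕ8≡z%ℕ8 (z +ℤ + 8 *ℤ + k) ⟩
  (z +ℤ + 8 *ℤ + k) %ℕ 8         ≡⟨ [z+8k]%ℕ8≡z%ℕ8 z k ⟩
  z %ℕ 8                         ∎
  where
  open ≡-Reasoning
  shift-out : ∀ z k → z +ℤ + 8 *ℤ (+ 1 +ℤ k) ≡ z +ℤ + 8 *ℤ k +ℤ + 8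
  shift-out = solve-∀

≃₈⇒%ℕ : ∀ {z n} → z ≃₈ n → z %ℕ 8 ≡ n % 8
≃₈⇒%ℕ {z} {n} (shifts k m eq) = begin
  z %ℕ 8                    ≡⟨ [z+8k]%ℕ8≡z%ℕ8 z k ⟨
  (z +ℤ + 8 *ℤ + k) %ℕ 8    ≡⟨ cong (_%ℕ 8) eq ⟩
  (+ n +ℤ + 8 *ℤ + m) %ℕ 8  ≡⟨ [z+8k]%ℕ8≡z%ℕ8 (+ n) m ⟩
  n % 8                     ∎
  where open ≡-Reasoning

+≃₈ : ∀ n → + n ≃₈ n
+≃₈ n = shifts 0 0 refl

≃₈-+ : ∀ {z w n m} → z ≃₈ n → w ≃₈ m → z +ℤ w ≃₈ n + m
≃₈-+ {z} {w} {n} {m} (shifts k₁ m₁ eq₁) (shifts k₂ m₂ eq₂) = shifts (k₁ + k₂) (m₁ + m₂) (begin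
  z +ℤ w +ℤ + 8 *ℤ + (k₁ + k₂)                  ≡⟨ regroup z w (+ k₁) (+ k₂) ⟩
  (z +ℤ + 8 *ℤ + k₁) +ℤ (w +ℤ + 8 *ℤ + k₂)      ≡⟨ cong₂ _+ℤ_ eq₁ eq₂ ⟩
  (+ n +ℤ + 8 *ℤ + m₁) +ℤ (+ m +ℤ + 8 *ℤ + m₂)  ≡⟨ regroup (+ n) (+ m) (+ m₁) (+ m₂) ⟨
  + n +ℤ + m +ℤ + 8 *ℤ + (m₁ + m₂)              ∎)
  where
  open ≡-Reasoning
  regroup : ∀ z w k₁ k₂ →
            z +ℤ w +ℤ + 8 *ℤ (k₁ +ℤ k₂) ≡ (z +ℤ + 8 *ℤ k₁) +ℤ (w +ℤ + 8 *ℤ k₂)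
  regroup = solve-∀

-- From z + 8k = n + 8m: −z + 8(n + m) = 7n + 8k.
≃₈-neg : ∀ {z n} → z ≃₈ n → - z ≃₈ 7 * n
≃₈-neg {z} {n} (shifts k m eq) = shifts (n + m) k (begin
  - z +ℤ + 8 *ℤ + (n + m)
    ≡⟨ expand z (+ n) (+ m) (+ k) ⟩
  + 7 *ℤ + n +ℤ + 8 *ℤ + k +ℤ (+ n +ℤ + 8 *ℤ + m -ℤ (z +ℤ + 8 *ℤ + k))
    ≡⟨ cong (λ w → + 7 *ℤ + n +ℤ + 8 *ℤ + k +ℤ (+ n +ℤ + 8 *ℤ + m -ℤ w)) eq ⟩
  + 7 *ℤ + n +ℤ + 8 *ℤ + k +ℤ (+ n +ℤ + 8 *ℤ + m -ℤ (+ n +ℤ + 8 *ℤ + m))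
    ≡⟨ cancel (+ n) (+ m) (+ k) ⟩
  + 7 *ℤ + n +ℤ + 8 *ℤ + k
    ≡⟨ cong (_+ℤ + 8 *ℤ + k) (pos-* 7 n) ⟨
  + (7 * n) +ℤ + 8 *ℤ + k
    ∎)
  where
  open ≡-Reasoning
  expand : ∀ z n m k →
           - z +ℤ + 8 *ℤ (n +ℤ m) ≡ + 7 *ℤ n +ℤ + 8 *ℤ k +ℤ (n +ℤ + 8 *ℤ m -ℤ (z +ℤ + 8 *ℤ k))
  expand = solve-∀
  cancel : ∀ n m k →
           + 7 *ℤ n +ℤ + 8 *ℤ k +ℤ (n +ℤ + 8 *ℤ m -ℤ (n +ℤ + 8 *ℤ m)) ≡ + 7 *ℤ n +ℤ + 8 *ℤ k
  cancel = solve-∀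

-- (−1)^∣S∣ modulo 8.
sign : ∀ {m} → Subset m → ℕ
sign []            = 1
sign (outside ∷ S) = sign S
sign (inside ∷ S)  = 7 * sign S

sizeParity-≃₈ : ∀ {m} (S : Subset m) {z n} → z ≃₈ n → sizeParity S z ≃₈ sign S * n
sizeParity-≃₈ []            {z} {n} z≃n = subst (z ≃₈_) (sym (*-identityˡ n)) z≃n
sizeParity-≃₈ (outside ∷ S) z≃n = sizeParity-≃₈ S z≃n
sizeParity-≃₈ (inside ∷ S)  {z} {n} z≃n =
  subst (sizeParity (inside ∷ S) z ≃₈_) (sym (*-assoc 7 (sign S) n)) (≃₈-neg (sizeParity-≃₈ S z≃n))

foldr-+-≃₈ : ∀ (xs : List X) {h : X → ℤ} {h′ : X → ℕ} → (∀ x → h x ≃₈ h′ x) →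
             foldr _+ℤ_ (+ 0) (map h xs) ≃₈ ∑ xs h′
foldr-+-≃₈ []       h≃h′ = +≃₈ 0
foldr-+-≃₈ (x ∷ xs) h≃h′ = ≃₈-+ (h≃h′ x) (foldr-+-≃₈ xs h≃h′)

möbius : ∀ {m} → Subset m → Subset m → ℕ
möbius A B = if subsetᵇ B A then sign A * sign B else 0

coeffA-linear : ∀ A x → coeffA A x ≡ (∑[ B ← P4 ] möbius A B * toℕ (x B)) % 8
coeffA-linear A x =
  ≃₈⇒%ℕ (subst (sizeParity A alternating ≃₈_) expand (sizeParity-≃₈ A (foldr-+-≃₈ P4 term≃)))
  where
  signedTerm : Subset 4 → ℤ
  signedTerm B = if subsetᵇ B A then sizeParity B (+ toℕ (x B)) else + 0
  alternating : ℤ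
  alternating = foldr _+ℤ_ (+ 0) (map signedTerm P4)
  term : Subset 4 → ℕ
  term B = if subsetᵇ B A then sign B * toℕ (x B) else 0
  term≃ : ∀ B → signedTerm B ≃₈ term B
  term≃ B with subsetᵇ B A
  ... | true  = sizeParity-≃₈ B (+≃₈ (toℕ (x B)))
  ... | false = +≃₈ 0
  sign-into : ∀ B → sign A * term B ≡ möbius A B * toℕ (x B)
  sign-into B with subsetᵇ B A
  ... | true  = sym (*-assoc (sign A) (sign B) (toℕ (x B)))
  ... | false = *-zeroʳ (sign A)
  expand : sign A * ∑ P4 term ≡ ∑[ B ← P4 ] möbius A B * toℕ (x B)
  expand = trans (∑-*ˡ P4 (sign A) term) (∑-cong P4 sign-into)

allSubset? : ∀ {n} {P : Subset n → Set} → (∀ A → Dec (P A)) → Dec (∀ A → P A)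
allSubset? {zero}  P? = map′ (λ { P[] [] → P[] }) (λ ∀P → ∀P []) (P? [])
allSubset? {suc n} P? = map′
  (λ { (∀Pi , ∀Po) (inside ∷ A) → ∀Pi A ; (∀Pi , ∀Po) (outside ∷ A) → ∀Po A })
  (λ ∀P → ∀P ∘ (inside ∷_) , ∀P ∘ (outside ∷_))
  (allSubset? (P? ∘ (inside ∷_)) ×-dec allSubset? (P? ∘ (outside ∷_)))

inZ? : ∀ x → Dec (InZ x)
inZ? x =
  (_ ℕ.≟ _) ×-dec (_ ℕ.≟ _) ×-dec
  allSubset? (λ A → (2 ≤? ∣ A ∣) →-dec (_ ℕ.≟ _)) ×-dec
  allSubset? (λ A → (2 ≤? ∣ A ∣) →-dec ¬? (¬? (e2 ∈? A) ×-dec ¬? (e4 ∈? A)) →-dec (_ ℕ.≟ _)) ×-dec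
  allSubset? (λ A → ((⁅ e2 ⁆ ∪ ⁅ e4 ⁆) ⊆? A) →-dec (_ ℕ.≟ _))

-- (Z2)–(Z4) say precisely that annihilator A · a_A ≡ 0 (mod 8) for every A.
annihilator : Subset 4 → ℕ
annihilator A with (⁅ e2 ⁆ ∪ ⁅ e4 ⁆) ⊆? A | 2 ≤? ∣ A ∣ | e2 ∈? A | e4 ∈? A
... | yes _ | _     | _     | _     = 1
... | no _  | no _  | _     | _     = 8
... | no _  | yes _ | yes _ | _     = 2
... | no _  | yes _ | no _  | yes _ = 2
... | no _  | yes _ | no _  | no _  = 4

annihilator-kills : ∀ x → InZ x → ∀ A → annihilator A * coeffA A x ≡₈ 0
annihilator-kills x (_ , _ , Z2 , Z3 , Z4) A
  with (⁅ e2 ⁆ ∪ ⁅ e4 ⁆) ⊆? A | 2 ≤? ∣ A ∣ | e2 ∈? A | e4 ∈? A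
... | yes 24⊆A | _         | _        | _        = mod₈ (cong (λ a → (1 * a) % 8) (Z4 A 24⊆A))
... | no _     | no _      | _        | _        = 8∣⇒≡₈0 (m∣m*n (coeffA A x))
... | no _     | yes 2≤∣A∣ | yes e2∈A | _        =
  %≡0⇒*≡₈0 2 4 {coeffA A x} refl (Z3 A 2≤∣A∣ λ (e2∉A , _) → e2∉A e2∈A)
... | no _     | yes 2≤∣A∣ | no _     | yes e4∈A =
  %≡0⇒*≡₈0 2 4 {coeffA A x} refl (Z3 A 2≤∣A∣ λ (_ , e4∉A) → e4∉A e4∈A)
... | no _     | yes 2≤∣A∣ | no _     | no _     = %≡0⇒*≡₈0 4 2 {coeffA A x} refl (Z2 A 2≤∣A∣)

-- a_A enters through its Möbius expansion, unreduced mod 8, so that this is linear in the tuple.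
constraintCombination : List (Subset 4) → (Subset 4 → ℕ) → ℕ
constraintCombination As v = ∑[ A ← As ] annihilator A * (∑[ B ← P4 ] möbius A B * v B)

constraintCombination-cong₈ : ∀ As {v w : Subset 4 → ℕ} → (∀ B → v B ≡₈ w B) →
                              constraintCombination As v ≡₈ constraintCombination As w
constraintCombination-cong₈ As v≡w =
  ∑-cong₈ As λ A → *-congˡ₈ (annihilator A) (∑-cong₈ P4 λ B → *-congˡ₈ (möbius A B) (v≡w B))

constraintCombination-∑ : ∀ As (xs : List X) (g : X → ℕ) (h : X → Subset 4 → ℕ) →
                          constraintCombination As (λ B → ∑[ x ← xs ] g x * h x B) ≡
                          ∑[ x ← xs ] g x * constraintCombination As (h x)
constraintCombination-∑ As xs g h = begin
  ∑[ A ← As ] annihilator A * (∑[ B ← P4 ] möbius A B * (∑[ x ← xs ] g x * h x B))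
    ≡⟨ ∑-cong As (λ A → cong (annihilator A *_) (∑-weighted-comm P4 xs (möbius A) g (λ B x → h x B))) ⟩
  ∑[ A ← As ] annihilator A * (∑[ x ← xs ] g x * (∑[ B ← P4 ] möbius A B * h x B))
    ≡⟨ ∑-weighted-comm As xs annihilator g (λ A x → ∑[ B ← P4 ] möbius A B * h x B) ⟩
  ∑[ x ← xs ] g x * constraintCombination As (h x)
    ∎
  where open ≡-Reasoning

InZ⇒constraintCombination≡₈0 : ∀ As x → InZ x → constraintCombination As (toℕ ∘ x) ≡₈ 0
InZ⇒constraintCombination≡₈0 As x x∈Z = begin
  constraintCombination As (toℕ ∘ x)
    ≈⟨ ∑-cong₈ As (λ A → *-congˡ₈ (annihilator A) (≡%8⇒≡₈ (coeffA-linear A x))) ⟨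
  ∑[ A ← As ] annihilator A * coeffA A x
    ≈⟨ ∑-≡₈0 As {λ A → annihilator A * coeffA A x} (annihilator-kills x x∈Z) ⟩
  0
    ∎
  where open import Relation.Binary.Reasoning.Setoid ≡₈-setoid

_⊑_ : Vec (Fin 3) n → Vec (Fin 3) n → Set
α ⊑ β = ∀ i → lookup α i ≡ zero ⊎ lookup α i ≡ lookup β i

nonzeroCount-mono : (α β : Vec (Fin 3) n) → α ⊑ β → nonzeroCount α ≤ nonzeroCount β
nonzeroCount-mono []      []      _   = z≤n
nonzeroCount-mono (a ∷ α) (b ∷ β) α⊑β with α⊑β zero
... | inj₁ refl = ≤-trans (nonzeroCount-mono α β (α⊑β ∘ suc)) (m≤n+m _ _)
... | inj₂ refl = +-monoʳ-≤ _ (nonzeroCount-mono α β (α⊑β ∘ suc))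

nonzeroCount-strict : (α β : Vec (Fin 3) n) → α ⊑ β → α ≢ β → nonzeroCount α < nonzeroCount β
nonzeroCount-strict []      []      _   α≢β = contradiction refl α≢β
nonzeroCount-strict (a ∷ α) (b ∷ β) α⊑β α≢β with a ≟ b | α⊑β zero
... | yes refl | _        = +-monoʳ-< _ (nonzeroCount-strict α β (α⊑β ∘ suc) (α≢β ∘ cong (a ∷_)))
... | no a≢b   | inj₂ a≡b = contradiction a≡b a≢b
... | no a≢b   | inj₁ refl with b
...   | zero  = contradiction refl a≢b
...   | suc _ = s≤s (nonzeroCount-mono α β (α⊑β ∘ suc))

SupportedOn : Vec (Fin 3) n → Fin n → Fin n → Set
SupportedOn α j k = ∀ i → i ≢ j → i ≢ k → lookup α i ≡ zero

supported-⊑ : ∀ (α β : Vec (Fin 3) n) {j k} → SupportedOn α j k →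
              lookup β j ≡ lookup α j → lookup β k ≡ lookup α k → α ⊑ β
supported-⊑ α β {j} {k} supp βj≡αj βk≡αk i with i ≟ j | i ≟ k
... | yes refl | _        = inj₂ (sym βj≡αj)
... | no _     | yes refl = inj₂ (sym βk≡αk)
... | no i≢j   | no i≢k   = inj₁ (supp i i≢j i≢k)

count≤0⇒zero : (α : Vec (Fin 3) n) → nonzeroCount α ≤ 0 → ∀ i → lookup α i ≡ zero
count≤0⇒zero (zero ∷ α) c≤0 zero    = refl
count≤0⇒zero (zero ∷ α) c≤0 (suc i) = count≤0⇒zero α c≤0 i

count≤1⇒single-support : (α : Vec (Fin 3) (suc n)) → nonzeroCount α ≤ 1 →
                         Σ (Fin (suc n)) λ j → ∀ i → i ≢ j → lookup α i ≡ zero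
count≤1⇒single-support (zero ∷ [])    _ = zero , λ { zero i≢0 → contradiction refl i≢0 }
count≤1⇒single-support (zero ∷ a ∷ α) c≤1 with count≤1⇒single-support (a ∷ α) c≤1
... | j , supp = suc j , λ { zero _ → refl ; (suc i) i≢j → supp i (i≢j ∘ cong suc) }
count≤1⇒single-support (suc _ ∷ α) (s≤s c≤0) =
  zero , λ { zero i≢0 → contradiction refl i≢0 ; (suc i) _ → count≤0⇒zero α c≤0 i }

InI⇒pair-support : (α : Vec (Fin 3) (suc (suc n))) → InI α → ∃₂ λ j k → j ≢ k × SupportedOn α j k
InI⇒pair-support (zero ∷ a ∷ []) _ =
  zero , suc zero , (λ ()) ,
  λ { zero i≢0 _ → contradiction refl i≢0 ; (suc zero) _ i≢1 → contradiction refl i≢1 }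
InI⇒pair-support (zero ∷ a ∷ b ∷ α) α∈I with InI⇒pair-support (a ∷ b ∷ α) α∈I
... | j , k , j≢k , supp = suc j , suc k , j≢k ∘ suc-injective ,
  λ { zero _ _ → refl ; (suc i) i≢j i≢k → supp i (i≢j ∘ cong suc) (i≢k ∘ cong suc) }
InI⇒pair-support (suc _ ∷ α) (s≤s c≤1) with count≤1⇒single-support α c≤1
... | k , supp = zero , suc k , (λ ()) ,
  λ { zero i≢0 _ → contradiction refl i≢0 ; (suc i) _ i≢k → supp i (i≢k ∘ cong suc) }

inIᵇ-sound : (α : Vec (Fin 3) n) → inIᵇ α ≡ true → InI α
inIᵇ-sound α inIᵇ≡true = ≤ᵇ⇒≤ (nonzeroCount α) 2 (subst T (sym inIᵇ≡true) _)

inIᵇ-complete : (α : Vec (Fin 3) n) → InI α → inIᵇ α ≡ true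
inIᵇ-complete α α∈I = dec-true (nonzeroCount α ≤? 2) α∈I

exponents : (n : ℕ) → List (Vec (Fin 3) n)
exponents n = allVec allFin3 n

∑-allFin3-point : ∀ a₀ (f : Fin 3 → ℕ) → (∀ a → a ≢ a₀ → f a ≡ 0) → ∑ allFin3 f ≡ f a₀
∑-allFin3-point 0F f f≡0 rewrite f≡0 1F (λ ()) | f≡0 2F (λ ()) = +-identityʳ _
∑-allFin3-point 1F f f≡0 rewrite f≡0 0F (λ ()) | f≡0 2F (λ ()) = +-identityʳ _
∑-allFin3-point 2F f f≡0 rewrite f≡0 0F (λ ()) | f≡0 1F (λ ()) = +-identityʳ _

∑-exponents-point : ∀ n (α₀ : Vec (Fin 3) n) (f : Vec (Fin 3) n → ℕ) →
                    (∀ α → α ≢ α₀ → f α ≡ 0) → ∑ (exponents n) f ≡ f α₀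
∑-exponents-point zero    []        f f≡0 = +-identityʳ (f [])
∑-exponents-point (suc n) (a₀ ∷ α₀) f f≡0 = begin
  ∑ (exponents (suc n)) f
    ≡⟨ ∑-concatMap allFin3 (λ a → map (a ∷_) (exponents n)) f ⟩
  ∑[ a ← allFin3 ] ∑ (map (a ∷_) (exponents n)) f
    ≡⟨ ∑-cong allFin3 (λ a → ∑-map (exponents n) (a ∷_) f) ⟩
  ∑[ a ← allFin3 ] ∑[ α ← exponents n ] f (a ∷ α)
    ≡⟨ ∑-allFin3-point a₀ _ other-heads-vanish ⟩
  ∑[ α ← exponents n ] f (a₀ ∷ α)
    ≡⟨ ∑-exponents-point n α₀ _ (λ α α≢α₀ → f≡0 _ (α≢α₀ ∘ ∷-injectiveʳ)) ⟩
  f (a₀ ∷ α₀)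
    ∎
  where
  open ≡-Reasoning
  other-heads-vanish : ∀ a → a ≢ a₀ → ∑[ α ← exponents n ] f (a ∷ α) ≡ 0
  other-heads-vanish a a≢a₀ = ∑-zero (exponents n) λ α → f≡0 _ (a≢a₀ ∘ ∷-injectiveˡ)

product-ones : (F : Fin n → ℕ) → (∀ i → F i ≡ 1) → product (tabulate F) ≡ 1
product-ones {zero}  F F≡1 = refl
product-ones {suc n} F F≡1 = cong₂ _*_ (F≡1 zero) (product-ones (F ∘ suc) (F≡1 ∘ suc))

product-single : (F : Fin n → ℕ) (j : Fin n) → (∀ i → i ≢ j → F i ≡ 1) → product (tabulate F) ≡ F j
product-single {suc n} F zero    F≡1 =
  trans (cong (F zero *_) (product-ones (F ∘ suc) λ i → F≡1 (suc i) λ ())) (*-identityʳ (F zero))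
product-single {suc n} F (suc j) F≡1 =
  trans (cong₂ _*_ (F≡1 zero λ ())
                   (product-single (F ∘ suc) j λ i i≢j → F≡1 (suc i) (i≢j ∘ suc-injective)))
        (*-identityˡ (F (suc j)))

product-pair : (F : Fin n → ℕ) (j k : Fin n) → j ≢ k → (∀ i → i ≢ j → i ≢ k → F i ≡ 1) →
               product (tabulate F) ≡ F j * F k
product-pair {suc n} F zero    zero    j≢k F≡1 = contradiction refl j≢k
product-pair {suc n} F zero    (suc k) j≢k F≡1 =
  cong (F zero *_) (product-single (F ∘ suc) k λ i i≢k → F≡1 (suc i) (λ ()) (i≢k ∘ suc-injective))
product-pair {suc n} F (suc j) zero    j≢k F≡1 =
  trans (cong (F zero *_) (product-single (F ∘ suc) j λ i i≢j → F≡1 (suc i) (i≢j ∘ suc-injective) (λ ())))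
        (*-comm (F zero) (F (suc j)))
product-pair {suc n} F (suc j) (suc k) j≢k F≡1 =
  trans (cong₂ _*_ (F≡1 zero (λ ()) (λ ()))
                   (product-pair (F ∘ suc) j k (j≢k ∘ cong suc)
                                 λ i i≢j i≢k → F≡1 (suc i) (i≢j ∘ suc-injective) (i≢k ∘ suc-injective)))
        (*-identityˡ _)

probe : Fin n → Fin n → Z8 → Z8 → Fin n → Z8
probe j k s t i = if does (i ≟ j) then s else if does (i ≟ k) then t else # 1

product-probe : ∀ {j k : Fin n} s t → j ≢ k → (G : Fin n → Z8 → ℕ) → (∀ i → G i (# 1) ≡ 1) →
                product (map (λ i → G i (probe j k s t i)) (allFin n)) ≡ G j s * G k t
product-probe {n} {j} {k} s t j≢k G G1≡1 = begin
  product (map (λ i → G i (x i)) (tabulate id))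
    ≡⟨ cong product (map-tabulate id (λ i → G i (x i))) ⟩
  product (tabulate (λ i → G i (x i)))
    ≡⟨ product-pair _ j k j≢k (λ i i≢j i≢k → trans (cong (G i) (x-elsewhere i i≢j i≢k)) (G1≡1 i)) ⟩
  G j (x j) * G k (x k)
    ≡⟨ cong₂ (λ u v → G j u * G k v) x-j x-k ⟩
  G j s * G k t
    ∎
  where
  open ≡-Reasoning
  x : Fin n → Z8
  x = probe j k s t
  x-j : x j ≡ s
  x-j rewrite dec-true (j ≟ j) refl = refl
  x-k : x k ≡ t
  x-k rewrite dec-false (k ≟ j) (j≢k ∘ sym) | dec-true (k ≟ k) refl = refl
  x-elsewhere : ∀ i → i ≢ j → i ≢ k → x i ≡ # 1
  x-elsewhere i i≢j i≢k rewrite dec-false (i ≟ j) i≢j | dec-false (i ≟ k) i≢k = refl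

probeMonomial : ℕ → ℕ → Fin 3 → Fin 3 → ℕ
probeMonomial s t p q = s * t * (s ^ toℕ p * t ^ toℕ q)

coefficient : (Vec (Fin 3) n → Bool) → Vec (Fin 3) n → ℕ
coefficient b α = if inIᵇ α ∧ b α then 1 else 0

toℕ-fOp-probe : ∀ (b : Vec (Fin 3) n → Bool) {j k} s t → j ≢ k →
  toℕ (fOp n b (probe j k s t)) ≡₈
  ∑[ α ← exponents n ] coefficient b α * probeMonomial (toℕ s) (toℕ t) (lookup α j) (lookup α k)
toℕ-fOp-probe {n} b {j} {k} s t j≢k = ≡%8⇒≡₈ (begin
  toℕ (fOp n b x)
    ≡⟨ toℕ-fromℕ< _ ⟩
  (prodAll x * ∑ (exponents n) term) % 8
    ≡⟨ cong (λ u → (u * ∑ (exponents n) term) % 8) prodAll-probe ⟩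
  (toℕ s * toℕ t * ∑ (exponents n) term) % 8
    ≡⟨ cong (_% 8) (∑-*ˡ (exponents n) (toℕ s * toℕ t) term) ⟩
  (∑[ α ← exponents n ] toℕ s * toℕ t * term α) % 8
    ≡⟨ cong (_% 8) (∑-cong (exponents n) weighted) ⟩
  (∑[ α ← exponents n ] coefficient b α * probeMonomial (toℕ s) (toℕ t) (lookup α j) (lookup α k)) % 8
    ∎)
  where
  open ≡-Reasoning
  x : Fin n → Z8
  x = probe j k s t
  prodAll-probe : prodAll x ≡ toℕ s * toℕ t
  prodAll-probe = product-probe s t j≢k (λ _ → toℕ) (λ _ → refl)
  monomial-probe : ∀ α → monomial α x ≡ toℕ s ^ toℕ (lookup α j) * toℕ t ^ toℕ (lookup α k)
  monomial-probe α =
    product-probe s t j≢k (λ i u → toℕ u ^ toℕ (lookup α i)) (λ i → ^-zeroˡ (toℕ (lookup α i)))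
  term : Vec (Fin 3) n → ℕ
  term α = if inIᵇ α ∧ b α then monomial α x else 0
  weighted : ∀ α → toℕ s * toℕ t * term α ≡
                   coefficient b α * probeMonomial (toℕ s) (toℕ t) (lookup α j) (lookup α k)
  weighted α with inIᵇ α ∧ b α
  ... | true  = trans (cong (toℕ s * toℕ t *_) (monomial-probe α)) (sym (+-identityʳ _))
  ... | false = *-zeroʳ (toℕ s * toℕ t)

-- U, V and the test sets were found by computer search; all that matters is that U and V lie
-- in Z and that testSet-separates holds.
U : Subset 4 → Z8
U (false ∷ false ∷ false ∷ false ∷ []) = # 7
U (true  ∷ false ∷ false ∷ false ∷ []) = # 0
U (false ∷ true  ∷ false ∷ false ∷ []) = # 5
U (true  ∷ true  ∷ false ∷ false ∷ []) = # 6
U (false ∷ false ∷ true  ∷ false ∷ []) = # 5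
U (true  ∷ false ∷ true  ∷ false ∷ []) = # 4
U (false ∷ true  ∷ true  ∷ false ∷ []) = # 7
U (true  ∷ true  ∷ true  ∷ false ∷ []) = # 6
U (false ∷ false ∷ false ∷ true  ∷ []) = # 3
U (true  ∷ false ∷ false ∷ true  ∷ []) = # 4
U (false ∷ true  ∷ false ∷ true  ∷ []) = # 1
U (true  ∷ true  ∷ false ∷ true  ∷ []) = # 2
U (false ∷ false ∷ true  ∷ true  ∷ []) = # 5
U (true  ∷ false ∷ true  ∷ true  ∷ []) = # 0
U (false ∷ true  ∷ true  ∷ true  ∷ []) = # 7
U (true  ∷ true  ∷ true  ∷ true  ∷ []) = # 2

V : Subset 4 → Z8
V (false ∷ false ∷ false ∷ false ∷ []) = # 7
V (true  ∷ false ∷ false ∷ false ∷ []) = # 2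
V (false ∷ true  ∷ false ∷ false ∷ []) = # 1
V (true  ∷ true  ∷ false ∷ false ∷ []) = # 0
V (false ∷ false ∷ true  ∷ false ∷ []) = # 0
V (true  ∷ false ∷ true  ∷ false ∷ []) = # 5
V (false ∷ true  ∷ true  ∷ false ∷ []) = # 2
V (true  ∷ true  ∷ true  ∷ false ∷ []) = # 7
V (false ∷ false ∷ false ∷ true  ∷ []) = # 5
V (true  ∷ false ∷ false ∷ true  ∷ []) = # 4
V (false ∷ true  ∷ false ∷ true  ∷ []) = # 7
V (true  ∷ true  ∷ false ∷ true  ∷ []) = # 2
V (false ∷ false ∷ true  ∷ true  ∷ []) = # 6
V (true  ∷ false ∷ true  ∷ true  ∷ []) = # 7
V (false ∷ true  ∷ true  ∷ true  ∷ []) = # 0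
V (true  ∷ true  ∷ true  ∷ true  ∷ []) = # 1

U∈Z : InZ U
U∈Z = toWitness {a? = inZ? U} tt

V∈Z : InZ V
V∈Z = toWitness {a? = inZ? V} tt

1∈Z : InZ (λ _ → # 1)
1∈Z = toWitness {a? = inZ? (λ _ → # 1)} tt

monomialTuple : Fin 3 → Fin 3 → Subset 4 → ℕ
monomialTuple p q B = probeMonomial (toℕ (U B)) (toℕ (V B)) p q

testSet : Fin 3 → Fin 3 → List (Subset 4)
testSet 0F 0F = ⁅ e2 ⁆ ∪ ⁅ e4 ⁆ ∷ ⁅ e1 ⁆ ∪ ⁅ e2 ⁆ ∪ ⁅ e4 ⁆ ∷ []
testSet 0F 1F = ⁅ e2 ⁆ ∪ ⁅ e3 ⁆ ∷ ⁅ e1 ⁆ ∪ ⁅ e2 ⁆ ∪ ⁅ e3 ⁆ ∷ ⁅ e2 ⁆ ∪ ⁅ e4 ⁆ ∷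
                ⁅ e1 ⁆ ∪ ⁅ e2 ⁆ ∪ ⁅ e4 ⁆ ∷ ⁅ e2 ⁆ ∪ ⁅ e3 ⁆ ∪ ⁅ e4 ⁆ ∷ ⊤ ∷ []
testSet 0F 2F = ⁅ e2 ⁆ ∪ ⁅ e3 ⁆ ∪ ⁅ e4 ⁆ ∷ ⊤ ∷ []
testSet 1F 0F = ⁅ e1 ⁆ ∪ ⁅ e2 ⁆ ∷ ⁅ e2 ⁆ ∪ ⁅ e3 ⁆ ∷ ⁅ e2 ⁆ ∪ ⁅ e4 ⁆ ∷ ⁅ e2 ⁆ ∪ ⁅ e3 ⁆ ∪ ⁅ e4 ⁆ ∷ []
testSet 1F 1F = ⁅ e1 ⁆ ∪ ⁅ e2 ⁆ ∷ ⁅ e1 ⁆ ∪ ⁅ e3 ⁆ ∷ ⁅ e2 ⁆ ∪ ⁅ e4 ⁆ ∷ []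
testSet 1F 2F = ⁅ e3 ⁆ ∪ ⁅ e4 ⁆ ∷ ⁅ e2 ⁆ ∪ ⁅ e3 ⁆ ∪ ⁅ e4 ⁆ ∷ []
testSet 2F 0F = ⁅ e1 ⁆ ∪ ⁅ e2 ⁆ ∪ ⁅ e4 ⁆ ∷ ⁅ e2 ⁆ ∪ ⁅ e3 ⁆ ∪ ⁅ e4 ⁆ ∷ []
testSet 2F 1F = ⁅ e1 ⁆ ∪ ⁅ e2 ⁆ ∪ ⁅ e3 ⁆ ∷ ⁅ e1 ⁆ ∪ ⁅ e2 ⁆ ∪ ⁅ e4 ⁆ ∷ ⁅ e3 ⁆ ∪ ⁅ e4 ⁆ ∷
                ⁅ e2 ⁆ ∪ ⁅ e3 ⁆ ∪ ⁅ e4 ⁆ ∷ ⊤ ∷ []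
testSet 2F 2F = ⊤ ∷ []

spike : Fin 3 → Fin 3 → Fin 3 → Fin 3 → ℕ
spike p q p′ q′ = if does (p′ ≟ p) ∧ does (q′ ≟ q) then 4 else 0

spike-diagonal : ∀ p q → spike p q p q ≡ 4
spike-diagonal p q rewrite dec-true (p ≟ p) refl | dec-true (q ≟ q) refl = refl

testSet-separates : ∀ p q p′ q′ →
                    constraintCombination (testSet p q) (monomialTuple p′ q′) ≡₈ spike p q p′ q′
testSet-separates = toWitness {a? = all? λ p → all? λ q → all? λ p′ → all? λ q′ → _ ≡₈? _} tt

4*coefficient≡₈0⇒false : ∀ (b : Vec (Fin 3) n → Bool) α → InI α →
                          4 * coefficient b α ≡₈ 0 → b α ≡ false
4*coefficient≡₈0⇒false b α α∈I rewrite inIᵇ-complete α α∈I with b α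
... | false = λ _ → refl
... | true  = λ { (mod₈ ()) }

module _ (b : Vec (Fin 3) n → Bool) where

  coefficientSum : Fin n → Fin n → (Fin 3 → Fin 3 → ℕ) → ℕ
  coefficientSum j k K = ∑[ α ← exponents n ] coefficient b α * K (lookup α j) (lookup α k)

  probe-constraint : Preserves n (fOp n b) → ∀ {j k} → j ≢ k → ∀ As →
                     coefficientSum j k (λ p q → constraintCombination As (monomialTuple p q)) ≡₈ 0
  probe-constraint f-preserves {j} {k} j≢k As = begin
    coefficientSum j k (λ p q → constraintCombination As (monomialTuple p q))
      ≡⟨ constraintCombination-∑ As (exponents n) (coefficient b) (λ α → monomialTuple (lookup α j) (lookup α k)) ⟨
    constraintCombination As
      (λ B → ∑[ α ← exponents n ] coefficient b α * monomialTuple (lookup α j) (lookup α k) B)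
      ≈⟨ constraintCombination-cong₈ As (λ B → toℕ-fOp-probe b (U B) (V B) j≢k) ⟨
    constraintCombination As (toℕ ∘ output)
      ≈⟨ InZ⇒constraintCombination≡₈0 As output (f-preserves inputs inputs∈Z) ⟩
    0
      ∎
    where
    open import Relation.Binary.Reasoning.Setoid ≡₈-setoid
    inputs : Fin n → Subset 4 → Z8
    inputs i B = probe j k (U B) (V B) i
    inputs∈Z : ∀ i → InZ (inputs i)
    inputs∈Z i with i ≟ j | i ≟ k
    ... | yes _ | _     = U∈Z
    ... | no _  | yes _ = V∈Z
    ... | no _  | no _  = 1∈Z
    output : Subset 4 → Z8
    output B = fOp n b (λ i → inputs i B)

  pair-supported-vanishes : Preserves n (fOp n b) → ∀ {j k} → j ≢ k → ∀ α₀ → InI α₀ → SupportedOn α₀ j k →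
    (∀ α → InI α → nonzeroCount α₀ < nonzeroCount α → b α ≡ false) → b α₀ ≡ false
  pair-supported-vanishes f-preserves {j} {k} j≢k α₀ α₀∈I supp vanish-above =
    4*coefficient≡₈0⇒false b α₀ α₀∈I (begin
      4 * coefficient b α₀
        ≡⟨ *-comm 4 (coefficient b α₀) ⟩
      coefficient b α₀ * 4
        ≡⟨ cong (coefficient b α₀ *_) (spike-diagonal p q) ⟨
      coefficient b α₀ * spike p q p q
        ≡⟨ ∑-exponents-point n α₀ _ others-vanish ⟨
      coefficientSum j k (spike p q)
        ≈⟨ ∑-cong₈ (exponents n) (λ α →
             *-congˡ₈ (coefficient b α) (testSet-separates p q (lookup α j) (lookup α k))) ⟨
      coefficientSum j k (λ p′ q′ → constraintCombination (testSet p q) (monomialTuple p′ q′))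
        ≈⟨ probe-constraint f-preserves j≢k (testSet p q) ⟩
      0
        ∎)
    where
    open import Relation.Binary.Reasoning.Setoid ≡₈-setoid
    p q : Fin 3
    p = lookup α₀ j
    q = lookup α₀ k
    others-vanish : ∀ α → α ≢ α₀ → coefficient b α * spike p q (lookup α j) (lookup α k) ≡ 0
    others-vanish α α≢α₀ with lookup α j ≟ p | lookup α k ≟ q
    ... | no _     | _        = *-zeroʳ (coefficient b α)
    ... | yes _    | no _     = *-zeroʳ (coefficient b α)
    ... | yes αj≡p | yes αk≡q with inIᵇ α in inIᵇ≡true | b α in bα≡true
    ...   | false | _     = refl
    ...   | true  | false = refl
    ...   | true  | true  = contradiction (trans (sym bα≡true) bα≡false) λ ()
      where
      α₀<α : nonzeroCount α₀ < nonzeroCount α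
      α₀<α = nonzeroCount-strict α₀ α (supported-⊑ α₀ α supp αj≡p αk≡q) (α≢α₀ ∘ sym)
      bα≡false : b α ≡ false
      bα≡false = vanish-above α (inIᵇ-sound α inIᵇ≡true) α₀<α

module _ (b : Vec (Fin 3) (2 + n) → Bool) (f-preserves : Preserves (2 + n) (fOp (2 + n) b)) where

  vanishes-if-larger-supports-vanish : ∀ α₀ → InI α₀ →
    (∀ α → InI α → nonzeroCount α₀ < nonzeroCount α → b α ≡ false) → b α₀ ≡ false
  vanishes-if-larger-supports-vanish α₀ α₀∈I vanish-above with InI⇒pair-support α₀ α₀∈I
  ... | j , k , j≢k , supp = pair-supported-vanishes b f-preserves j≢k α₀ α₀∈I supp vanish-above

  vanishes-downward : ∀ m α → InI α → 2 ≤ m + nonzeroCount α → b α ≡ false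
  vanishes-downward zero    α α∈I 2≤cα = vanishes-if-larger-supports-vanish α α∈I λ β β∈I cα<cβ →
    contradiction (≤-<-trans 2≤cα (<-≤-trans cα<cβ β∈I)) (<-irrefl refl)
  vanishes-downward (suc m) α α∈I 2≤m+1+cα = vanishes-if-larger-supports-vanish α α∈I λ β β∈I cα<cβ →
    vanishes-downward m β β∈I
      (≤-trans 2≤m+1+cα (subst (_≤ m + nonzeroCount β) (+-suc m _) (+-monoʳ-≤ m cα<cβ)))

lemma3p8 : (n : ℕ) → 2 ≤ n → (b : Vec (Fin 3) n → Bool) →
    Preserves n (fOp n b) →
    (α : Vec (Fin 3) n) → InI α → b α ≡ false
lemma3p8 (suc (suc n)) (s≤s (s≤s z≤n)) b f-preserves α α∈I =
  vanishes-downward b f-preserves 2 α α∈I (m≤m+n 2 (nonzeroCount α))
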